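{- Let $S$ be a decision rule system with $n(S)>0$, and let $C\in\{EAR,AR,EAD,AD,ESR,SR\}$. Let $\alpha=\{a_{i_1}=\delta_1,\dots,a_{i_m}=\delta_m\}$ be a consistent system of equations such that $a_{i_1},\dots,a_{i_m}\in A(S)$ and, for $j=1,\dots,m$, $\delta_j\in EV_S(a_{i_j})$ if $C\in\{EAR,EAD,ESR\}$ and $\delta_j\in V_S(a_{i_j})$ if $C\in\{AR,AD,SR\}$. Assume $S_\alpha\ne\emptyset$. Then $h_C(S)\ge h_C(S_\alpha)$.
   Context: Let $\omega=\{0,1,2,\dots\}$ and let $\{a_i:i\in\omega\}$ be a set of attributes. A decision rule $r$ is an expression $(a_{i_1}=\delta_1)\wedge\cdots\wedge(a_{i_m}=\delta_m)\to\sigma$ with $m\in\omega$, pairwise different attributes, and $\delta_j,\sigma\in\omega$. Its right-hand side is $\sigma$, $A(r)=\{a_{i_1},\dots,a_{i_m}\}$, and $K(r)=\{a_{i_1}=\delta_1,\dots,a_{i_m}=\delta_m\}$. Two rules are equal iff they have the same $K(\cdot)$ and the same right-hand side. A decision rule system $S$ is a finite nonempty set of decision rules. Let $A(S)=\bigcup_{r\in S}A(r)$, $n(S)=|A(S)|$, and let $D(Z)$ be the set of right-hand sides of rules in $Z\subseteq S$. For $a_i\in A(S)$, $V_S(a_i)=\{\delta:(a_i=\delta)\in\bigcup_{r\in S}K(r)\}$ and $EV_S(a_i)=V_S(a_i)\cup\{*\}$, where $*$ is a symbol not in $\omega$. A set of equations $\{a_{i_1}=\delta_1,\dots,a_{i_m}=\delta_m\}$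 with $\delta_j\in\omega\cup\{*\}$ is inconsistent if there are $l\ne t$ with $i_l=i_t$ and $\delta_l\ne\delta_t$, and consistent otherwise. For a consistent equation system $\alpha$ and a rule $r$ with $K(r)\cup\alpha$ consistent, $r_\alpha$ is the rule obtained from $r$ by deleting from its left-hand side all equations that belong to $\alpha$. Then $S_\alpha=\{r_\alpha: r\in S,\ K(r)\cup\alpha \text{ consistent}\}$. A decision tree over $S$ is a finite directed rooted tree with working nodes labeled by attributes from $A(S)$ and terminal nodes labeled by subsets of $S$. In an o-tree, a working node labeled $a_i$ has exactly $|V_S(a_i)|$ outgoing edges, labeled with pairwise distinct elements of $V_S(a_i)$. In an e-tree, it has exactly $|EV_S(a_i)|$ outgoing edges, labeled with pairwise distinct elements of $EV_S(a_i)$. For a complete path $\xi$ (root to terminal node), $K(\xi)$ is the set of equations $a_i=\delta$ with $a_i$ labeling a working node of $\xi$ and $\delta$ labeling the edge of $\xi$ leaving it. $\tau(\xi)$ is the label of the terminal node of $\xi$, and $h(\xi)$ is the number of working nodes of $\xi$. The depth $h(\Gamma)$ is the maximum of $h(\xi)$ over complete paths. An o-tree (resp. e-tree) solves $AR(S)$ (resp. $EAR(S)$) if every complete path $\xi$ with $K(\xi)$ consistent satisfies: $K(r)\subseteq K(\xi)$ for all $r\in\tau(\xi)$, and $K(r)\cup K(\xi)$ is inconsistent for all $r\in S\setminus\tau(\xi)$. It solves $AD(S)$ (resp. $EAD(S)$) if every such $\xi$ satisfies: $K(r)\subseteq K(\xi)$ for $r\in\tau(\xi)$, and $K(r)\cup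 K(\xi)$ is inconsistent for each $r\in S\setminus\tau(\xi)$ whose right-hand side is not in $D(\tau(\xi))$. It solves $SR(S)$ (resp. $ESR(S)$) if every such $\xi$ satisfies: $K(r)\subseteq K(\xi)$ for $r\in\tau(\xi)$, and if $\tau(\xi)=\emptyset$ then $K(r)\cup K(\xi)$ is inconsistent for all $r\in S$. For $C\in\{AR,EAR,AD,EAD,SR,ESR\}$, $h_C(S)$ is the minimum depth of a decision tree over $S$ solving $C(S)$. If $n(S)=0$, this is $0$. -}

module Defs where

open import Data.Nat using (ℕ; _≤_)
open import Data.Nat.Properties using () renaming (_≟_ to _≟ℕ_)
open import Data.Fin using (Fin)
open import Data.Bool using (Bool)
open import Data.List using (List; []; _∷_; _++_; map; filter)
open import Data.List.Relation.Unary.Any using (Any; any?)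
open import Data.List.Relation.Unary.All using (All)
open import Data.List.Relation.Unary.Unique.Propositional using (Unique)
open import Data.List.Membership.Propositional using (_∈_)
open import Data.List.Membership.DecPropositional as DecMem using ()
open import Data.Product using (Σ; ∃; _×_; _,_; proj₁; proj₂)
open import Data.Product.Properties using (≡-dec)
open import Data.Sum using (_⊎_)
open import Relation.Nullary using (¬_; Dec; yes; no)
open import Relation.Nullary.Decidable using (_×-dec_; ¬?)
open import Relation.Binary.PropositionalEquality using (_≡_; _≢_; refl)
open import Relation.Binary.Definitions using (DecidableEquality)
open import Function.Bundles using (_⇔_)

data EVal : Set where
  val  : ℕ → EVal
  star : EVal

_≟E_ : DecidableEquality EVal
val m ≟E val n with m ≟ℕ n
... | yes refl = yes refl
... | no m≢n = no λ { refl → m≢n refl }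
val _ ≟E star = no λ ()
star ≟E val _ = no λ ()
star ≟E star = yes refl

-- An equation a_i = δ is the pair (i , δ).
Eqn : Set
Eqn = ℕ × EVal

_≟Eqn_ : DecidableEquality Eqn
_≟Eqn_ = ≡-dec _≟ℕ_ _≟E_

Inconsistent : List Eqn → Set
Inconsistent E = Any (λ e → Any (λ e' → (proj₁ e ≡ proj₁ e') × (proj₂ e ≢ proj₂ e')) E) E

Consistent : List Eqn → Set
Consistent E = ¬ Inconsistent E

inconsistent? : (E : List Eqn) → Dec (Inconsistent E)
inconsistent? E = any? (λ e → any? (λ e' → (proj₁ e ≟ℕ proj₁ e') ×-dec ¬? (proj₂ e ≟E proj₂ e')) E) E

consistent? : (E : List Eqn) → Dec (Consistent E)
consistent? E = ¬? (inconsistent? E)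

-- Decision rules:  (a_{i1}=δ1) ∧ ... ∧ (a_{im}=δm) → σ
-- lhs is the list of pairs (i_j , δ_j), rhs is σ.

record Rule : Set where
  constructor _⇒_
  field
    lhs : List (ℕ × ℕ)
    rhs : ℕ
open Rule public

WFRule : Rule → Set
WFRule r = Unique (map proj₁ (lhs r))

K : Rule → List Eqn
K r = map (λ p → proj₁ p , val (proj₂ p)) (lhs r)

_⊆E_ : List Eqn → List Eqn → Set
E ⊆E F = ∀ {e} → e ∈ E → e ∈ F

_≈R_ : Rule → Rule → Set
r ≈R r' = (K r ⊆E K r') × (K r' ⊆E K r) × (rhs r ≡ rhs r')

-- membership in a set of rules (rule systems / subsets are represented by
-- lists, read as sets modulo rule equality)
_∈R_ : Rule → List Rule → Set
r ∈R L = Any (λ r' → r ≈R r') L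

_∈A_ : ℕ → List Rule → Set
a ∈A S = Any (λ r → a ∈ map proj₁ (lhs r)) S

PosN : List Rule → Set
PosN S = ∃ λ a → a ∈A S

InV : List Rule → ℕ → ℕ → Set
InV S a δ = Any (λ r → (a , δ) ∈ lhs r) S

-- modes: ordinary (o-trees, V_S) / extended (e-trees, EV_S)
data Mode : Set where
  ordinary extended : Mode

Allowed : Mode → List Rule → ℕ → EVal → Set
Allowed ordinary S a e = ∃ λ δ → (e ≡ val δ) × InV S a δ
Allowed extended S a e = (e ≡ star) ⊎ (∃ λ δ → (e ≡ val δ) × InV S a δ)

restrictRule : List Eqn → Rule → Rule
restrictRule α r =
  filter (λ p → ¬? (DecMem._∈?_ _≟Eqn_ (proj₁ p , val (proj₂ p)) α)) (lhs r) ⇒ rhs r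

restrictSys : List Rule → List Eqn → List Rule
restrictSys S α = map (restrictRule α) (filter (λ r → consistent? (K r ++ α)) S)

data Tree : Set where
  leaf : List Rule → Tree
  node : (a : ℕ) (k : ℕ) (lab : Fin k → EVal) (sub : Fin k → Tree) → Tree

TreeOver : Mode → List Rule → Tree → Set
TreeOver m S (leaf L) = All (λ r → r ∈R S) L
TreeOver m S (node a k lab sub) =
  (a ∈A S)
  × (∀ i j → lab i ≡ lab j → i ≡ j)
  × (∀ e → (∃ λ i → lab i ≡ e) ⇔ Allowed m S a e)
  × (∀ i → TreeOver m S (sub i))

data Path : Tree → Set where
  end  : ∀ {L} → Path (leaf L)
  step : ∀ {a k lab sub} (i : Fin k) → Path (sub i) → Path (node a k lab sub)

KP : ∀ {Γ} → Path Γ → List Eqn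
KP end = []
KP (step {a} {lab = lab} i ξ) = (a , lab i) ∷ KP ξ

τ : ∀ {Γ} → Path Γ → List Rule
τ (end {L}) = L
τ (step i ξ) = τ ξ

h : ∀ {Γ} → Path Γ → ℕ
h end = 0
h (step i ξ) = Data.Nat.suc (h ξ)

DepthLE : Tree → ℕ → Set
DepthLE Γ d = (ξ : Path Γ) → h ξ ≤ d

data Problem : Set where
  EAR AR EAD AD ESR SR : Problem

mode : Problem → Mode
mode EAR = extended
mode AR  = ordinary
mode EAD = extended
mode AD  = ordinary
mode ESR = extended
mode SR  = ordinary

data Kind : Set where
  kAR kAD kSR : Kind

kind : Problem → Kind
kind EAR = kAR
kind AR  = kAR
kind EAD = kAD
kind AD  = kAD
kind ESR = kSR
kind SR  = kSR

PathCond : Kind → List Rule → ∀ {Γ} → Path Γ → Set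
PathCond kAR S ξ =
  (∀ {r} → r ∈ τ ξ → K r ⊆E KP ξ)
  × (∀ {r} → r ∈ S → ¬ (r ∈R τ ξ) → Inconsistent (K r ++ KP ξ))
PathCond kAD S ξ =
  (∀ {r} → r ∈ τ ξ → K r ⊆E KP ξ)
  × (∀ {r} → r ∈ S → ¬ (rhs r ∈ map rhs (τ ξ)) → Inconsistent (K r ++ KP ξ))
PathCond kSR S ξ =
  (∀ {r} → r ∈ τ ξ → K r ⊆E KP ξ)
  × (τ ξ ≡ [] → ∀ {r} → r ∈ S → Inconsistent (K r ++ KP ξ))

Solves : Problem → List Rule → Tree → Set
Solves C S Γ = (ξ : Path Γ) → Consistent (KP ξ) → PathCond (kind C) S ξ

-- h_C(S) ≤ d   (h_C(S) = 0 if n(S) = 0, else the minimum depth of a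
-- decision tree over S solving C(S))
HC≤ : Problem → List Rule → ℕ → Set
HC≤ C S d = (¬ PosN S) ⊎ (∃ λ Γ → TreeOver (mode C) S Γ × Solves C S Γ × DepthLE Γ d)

-- Restrict a tree Γ solving C(S) to S_α: a node whose attribute no longer occurs in
-- S_α is removed together with all its edges but the one labelled by the default
-- value v(a): the value α assigns to a, or else an arbitrary admissible one. Every
-- other node keeps exactly the edges admissible in S_α, and every terminal label L
-- becomes L_α.
-- A path ξ′ of the new tree comes from a path ξ of Γ that is at least as long and
-- whose extra equations all have the form a = v(a) with a ∉ A(S_α). The attributes
-- of α are not in A(S_α) and v agrees with α on them, so equations a = v(a) can
-- never take part in a conflict with equations over A(S_α). Hence K(ξ) ∪ α is
-- consistent when K(ξ′) is, and the conditions of C(S) along ξ carry over to the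
-- conditions of C(S_α) along ξ′.
module Submission where

open import Defs
open import Data.Nat using (ℕ; _≤_; z≤n; s≤s)
open import Data.Nat.Properties using (≤-trans; m≤n⇒m≤1+n) renaming (_≟_ to _≟ℕ_)
open import Data.Fin using (Fin; zero; suc)
open import Data.List using (List; []; _∷_; _++_; map; filter; length; lookup; allFin)
open import Data.List.Properties using (filter-accept)
open import Data.List.Relation.Unary.All as All using (All)
open import Data.List.Relation.Unary.Any as Any using (Any; here; there; any?)
open import Data.List.Relation.Unary.Any.Properties using (lookup-index)
open import Data.List.Relation.Unary.AllPairs using (_∷_)
open import Data.List.Relation.Unary.Unique.Propositional using (Unique)
open import Data.List.Relation.Unary.Unique.Propositional.Properties using (allFin⁺; filter⁺)
open import Data.List.Membership.Propositional using (_∈_; _∉_; find; lose)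
open import Data.List.Membership.Propositional.Properties
  using (∈-map⁺; ∈-map⁻; ∈-filter⁺; ∈-filter⁻; ∈-++⁺ˡ; ∈-++⁺ʳ; ∈-++⁻; ∈-lookup; ∈-allFin)
import Data.List.Membership.DecPropositional as DecMembership
open import Data.List.Relation.Binary.Subset.Propositional using (_⊆_)
open import Data.List.Relation.Binary.Subset.Propositional.Properties using (Any-resp-⊆; xs⊆xs++ys; ++⁺ˡ; filter-⊆)
open import Data.Product using (∃; _×_; _,_; proj₁; proj₂)
open import Data.Product.Properties using (≡-dec)
open import Data.Sum as Sum using (_⊎_; inj₁; inj₂)
open import Data.Empty using (⊥-elim)
open import Function using (_∘_)
open import Function.Bundles using (_⇔_; mk⇔; Equivalence)
open import Relation.Nullary using (¬_; Dec; yes; no)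
open import Relation.Nullary.Decidable using (¬?; map′)
open import Relation.Unary using (Decidable)
open import Relation.Binary.PropositionalEquality using (_≡_; _≢_; refl; sym; trans; cong; subst)

inconsistent-pair : ∀ {X x y} → x ∈ X → y ∈ X → proj₁ x ≡ proj₁ y → proj₂ x ≢ proj₂ y → Inconsistent X
inconsistent-pair x∈X y∈X same differ = lose x∈X (lose y∈X (same , differ))

inconsistent-⊆ : ∀ {X Y} → X ⊆ Y → Inconsistent X → Inconsistent Y
inconsistent-⊆ X⊆Y = Any-resp-⊆ X⊆Y ∘ Any.map (Any-resp-⊆ X⊆Y)

consistent-⊆ : ∀ {X Y} → X ⊆ Y → Consistent Y → Consistent X
consistent-⊆ X⊆Y Y-consistent = Y-consistent ∘ inconsistent-⊆ X⊆Y

module Covering (P : ℕ → Set) (v : ℕ → EVal) where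

  Covered : List Eqn → Eqn → Set
  Covered X x = x ∈ X ⊎ (¬ P (proj₁ x) × proj₂ x ≡ v (proj₁ x))

  covered-inconsistent : ∀ {L X} → (∀ {x} → x ∈ L → Covered X x) →
                         (∀ {x} → x ∈ X → P (proj₁ x)) → Inconsistent L → Inconsistent X
  covered-inconsistent cover inP inc with find inc
  ... | x , x∈L , conflict with find conflict
  ... | y , y∈L , same , differ with cover x∈L | cover y∈L
  ... | inj₁ x∈X       | inj₁ y∈X       = inconsistent-pair x∈X y∈X same differ
  ... | inj₁ x∈X       | inj₂ (y∉P , _) = ⊥-elim (y∉P (subst P same (inP x∈X)))
  ... | inj₂ (x∉P , _) | inj₁ y∈X       = ⊥-elim (x∉P (subst P (sym same) (inP y∈X)))
  ... | inj₂ (_ , x≡v) | inj₂ (_ , y≡v) = ⊥-elim (differ (trans x≡v (trans (cong v same) (sym y≡v))))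

_∈A?_ : (a : ℕ) (L : List Rule) → Dec (a ∈A L)
a ∈A? L = any? (λ r → DecMembership._∈?_ _≟ℕ_ a (map proj₁ (lhs r))) L

InV? : (L : List Rule) (a δ : ℕ) → Dec (InV L a δ)
InV? L a δ = any? (λ r → DecMembership._∈?_ (≡-dec _≟ℕ_ _≟ℕ_) (a , δ) (lhs r)) L

allowed? : (md : Mode) (L : List Rule) (a : ℕ) (e : EVal) → Dec (Allowed md L a e)
allowed? ordinary L a (val δ) = map′ (λ inV → δ , refl , inV) (λ { (_ , refl , inV) → inV }) (InV? L a δ)
allowed? ordinary L a star    = no λ { (_ , () , _) }
allowed? extended L a (val δ) =
  map′ (λ inV → inj₂ (δ , refl , inV)) (λ { (inj₁ ()) ; (inj₂ (_ , refl , inV)) → inV }) (InV? L a δ)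
allowed? extended L a star    = yes (inj₁ refl)

InV⇒Allowed : ∀ md {L a δ} → InV L a δ → Allowed md L a (val δ)
InV⇒Allowed ordinary inV = _ , refl , inV
InV⇒Allowed extended inV = inj₂ (_ , refl , inV)

∈A⇒InV : ∀ {L a} → a ∈A L → ∃ λ δ → InV L a δ
∈A⇒InV a∈L with find a∈L
... | r , r∈L , a∈r with ∈-map⁻ proj₁ a∈r
... | (_ , δ) , aδ∈r , refl = δ , lose r∈L aδ∈r

∈lhs⇒∈K : ∀ r {a δ} → (a , δ) ∈ lhs r → (a , val δ) ∈ K r
∈lhs⇒∈K _ = ∈-map⁺ (λ p → proj₁ p , val (proj₂ p))

∈K⇒∈A : ∀ {L r e} → e ∈ K r → r ∈ L → proj₁ e ∈A L
∈K⇒∈A e∈r r∈L with ∈-map⁻ _ e∈r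
... | p , p∈r , refl = lose r∈L (∈-map⁺ proj₁ p∈r)

∈R⇒∈A : ∀ {L r e} → r ∈R L → e ∈ K r → proj₁ e ∈A L
∈R⇒∈A r∈L e∈r with find r∈L
... | s , s∈L , (Kr⊆Ks , _ , _) = ∈K⇒∈A (Kr⊆Ks e∈r) s∈L

outside? : (α : List Eqn) (p : ℕ × ℕ) → Dec ((proj₁ p , val (proj₂ p)) ∉ α)
outside? α p = ¬? (DecMembership._∈?_ _≟Eqn_ (proj₁ p , val (proj₂ p)) α)

∈-K-restrictRule⁻ : ∀ α r {e} → e ∈ K (restrictRule α r) → e ∈ K r × e ∉ α
∈-K-restrictRule⁻ α r e∈ with ∈-map⁻ _ e∈
... | p , p∈ , refl with ∈-filter⁻ (outside? α) {xs = lhs r} p∈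
... | p∈r , p∉α = ∈-map⁺ _ p∈r , p∉α

∈-K-restrictRule⁺ : ∀ α r {e} → e ∈ K r → e ∉ α → e ∈ K (restrictRule α r)
∈-K-restrictRule⁺ α r e∈r e∉α with ∈-map⁻ _ e∈r
... | p , p∈r , refl = ∈-map⁺ _ (∈-filter⁺ (outside? α) p∈r e∉α)

restrictRule-≈R : ∀ α {r s} → r ≈R s → restrictRule α r ≈R restrictRule α s
restrictRule-≈R α {r} {s} (Kr⊆Ks , Ks⊆Kr , same-rhs) =
  (λ e∈ → let e∈r , e∉α = ∈-K-restrictRule⁻ α r e∈ in ∈-K-restrictRule⁺ α s (Kr⊆Ks e∈r) e∉α) ,
  (λ e∈ → let e∈s , e∉α = ∈-K-restrictRule⁻ α s e∈ in ∈-K-restrictRule⁺ α r (Ks⊆Kr e∈s) e∉α) ,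
  same-rhs

∈-restrictSys⁻ : ∀ {L α r} → r ∈ restrictSys L α →
                 ∃ λ s → s ∈ L × Consistent (K s ++ α) × r ≡ restrictRule α s
∈-restrictSys⁻ {L} {α} r∈ with ∈-map⁻ (restrictRule α) r∈
... | s , s∈ , refl with ∈-filter⁻ (λ r → consistent? (K r ++ α)) {xs = L} s∈
... | s∈L , s-consistent = s , s∈L , s-consistent , refl

∈-restrictSys⁺ : ∀ {L α s} → s ∈ L → Consistent (K s ++ α) → restrictRule α s ∈ restrictSys L α
∈-restrictSys⁺ {α = α} s∈L s-consistent =
  ∈-map⁺ (restrictRule α) (∈-filter⁺ (λ r → consistent? (K r ++ α)) s∈L s-consistent)

∈R-restrictSys⁺ : ∀ {L α r} → r ∈R L → Consistent (K r ++ α) → restrictRule α r ∈R restrictSys L α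
∈R-restrictSys⁺ {α = α} r∈L r-consistent with find r∈L
... | s , s∈L , r≈s@(_ , Ks⊆Kr , _) =
  lose (∈-restrictSys⁺ s∈L (consistent-⊆ (++⁺ˡ α Ks⊆Kr) r-consistent)) (restrictRule-≈R α r≈s)

restrictSys-∈R : ∀ {L S α r} → All (_∈R S) L → r ∈ restrictSys L α → r ∈R restrictSys S α
restrictSys-∈R L⊆S r∈ with ∈-restrictSys⁻ r∈
... | s , s∈L , s-consistent , refl = ∈R-restrictSys⁺ (All.lookup L⊆S s∈L) s-consistent

restrictSys-≡[] : ∀ {L α} → (∀ {r} → r ∈ L → Consistent (K r ++ α)) → restrictSys L α ≡ [] → L ≡ []
restrictSys-≡[] {[]} _ _ = refl
restrictSys-≡[] {r ∷ L} {α} consistent eq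
  with () ← subst (λ rs → map (restrictRule α) rs ≡ [])
                  (filter-accept (λ r → consistent? (K r ++ α)) (consistent (here refl))) eq

InV-restrictSys : ∀ {S α a δ} → InV (restrictSys S α) a δ → InV S a δ
InV-restrictSys {S} inV with find inV
... | r , r∈ , aδ∈r with ∈-restrictSys⁻ {L = S} r∈
... | s , s∈S , _ , refl = lose s∈S (filter-⊆ (outside? _) (lhs s) aδ∈r)

Allowed-restrictSys : ∀ md {S α a e} → Allowed md (restrictSys S α) a e → Allowed md S a e
Allowed-restrictSys ordinary (δ , e≡δ , inV)        = δ , e≡δ , InV-restrictSys inV
Allowed-restrictSys extended (inj₁ e≡*)             = inj₁ e≡*
Allowed-restrictSys extended (inj₂ (δ , e≡δ , inV)) = inj₂ (δ , e≡δ , InV-restrictSys inV)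

α-attr-∉A : ∀ S α {a e} → (a , e) ∈ α → ¬ a ∈A restrictSys S α
α-attr-∉A S α {a} a∈α a∈Sα with ∈A⇒InV a∈Sα
... | δ , inV with find inV
... | r , r∈ , aδ∈r with ∈-restrictSys⁻ {L = S} r∈
... | s , _ , s-consistent , refl with ∈-K-restrictRule⁻ α s (∈lhs⇒∈K (restrictRule α s) aδ∈r)
... | aδ∈s , aδ∉α = s-consistent (inconsistent-pair (∈-++⁺ˡ aδ∈s) (∈-++⁺ʳ (K s) a∈α) refl
                      λ δ≡e → aδ∉α (subst (λ e → (a , e) ∈ α) (sym δ≡e) a∈α))

lookup-injective : ∀ {A : Set} {xs : List A} → Unique xs → ∀ i j → lookup xs i ≡ lookup xs j → i ≡ j
lookup-injective {xs = _ ∷ _} (_ ∷ _) zero zero _ = refl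
lookup-injective {xs = _ ∷ _} (x∉xs ∷ _) zero (suc j) eq = ⊥-elim (All.lookup x∉xs (∈-lookup j) eq)
lookup-injective {xs = _ ∷ _} (x∉xs ∷ _) (suc i) zero eq = ⊥-elim (All.lookup x∉xs (∈-lookup i) (sym eq))
lookup-injective {xs = _ ∷ _} (_ ∷ unique) (suc i) (suc j) eq = cong suc (lookup-injective unique i j eq)

module _ {A : Set} {Q : A → Set} (Q? : Decidable Q) {k} (lab : Fin k → A) where

  selectEdges : List (Fin k)
  selectEdges = filter (Q? ∘ lab) (allFin k)

  selectEdges-injective : (∀ i j → lab i ≡ lab j → i ≡ j) →
                          ∀ i j → lab (lookup selectEdges i) ≡ lab (lookup selectEdges j) → i ≡ j
  selectEdges-injective injective i j =
    lookup-injective (filter⁺ (Q? ∘ lab) (allFin⁺ k)) i j ∘ injective _ _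

  selectEdges-image : (∀ {x} → Q x → ∃ λ i → lab i ≡ x) →
                      ∀ x → (∃ λ j → lab (lookup selectEdges j) ≡ x) ⇔ Q x
  selectEdges-image surjective x = mk⇔
    (λ { (j , refl) → proj₂ (∈-filter⁻ (Q? ∘ lab) {xs = allFin k} (∈-lookup j)) })
    (λ Qx → let i , lab-i≡x = surjective Qx
                i∈ = ∈-filter⁺ (Q? ∘ lab) (∈-allFin i) (subst Q (sym lab-i≡x) Qx)
            in Any.index i∈ , trans (cong lab (sym (lookup-index i∈))) lab-i≡x)

τ-∈R : ∀ {md S Γ} → TreeOver md S Γ → (ξ : Path Γ) → All (_∈R S) (τ ξ)
τ-∈R rules end = rules
τ-∈R (_ , _ , _ , over) (step i ξ) = τ-∈R (over i) ξ

module Restriction (md : Mode) (S : List Rule) (α : List Eqn) (α-consistent : Consistent α)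
                   (α-allowed : All (λ e → (proj₁ e ∈A S) × Allowed md S (proj₁ e) (proj₂ e)) α) where

  Sα : List Rule
  Sα = restrictSys S α

  default : ℕ → EVal
  default a with any? (λ e → proj₁ e ≟ℕ a) α
  ... | yes a∈α = proj₂ (proj₁ (find a∈α))
  ... | no _ with a ∈A? S
  ...   | yes a∈S = val (proj₁ (∈A⇒InV a∈S))
  ...   | no _    = star

  default-α : ∀ {a e} → (a , e) ∈ α → default a ≡ e
  default-α {a} {e} a∈α with any? (λ e → proj₁ e ≟ℕ a) α
  ... | no a∉α = ⊥-elim (a∉α (lose a∈α refl))
  ... | yes a∈α′ with find a∈α′
  ...   | (_ , e′) , e′∈α , refl with e′ ≟E e
  ...     | yes e′≡e = e′≡e
  ...     | no e′≢e  = ⊥-elim (α-consistent (inconsistent-pair e′∈α a∈α refl e′≢e))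

  default-allowed : ∀ {a} → a ∈A S → Allowed md S a (default a)
  default-allowed {a} a∈S with any? (λ e → proj₁ e ≟ℕ a) α
  ... | yes a∈α with find a∈α
  ...   | _ , e∈α , refl = proj₂ (All.lookup α-allowed e∈α)
  default-allowed {a} a∈S | no _ with a ∈A? S
  ... | yes a∈S′ = InV⇒Allowed md (proj₂ (∈A⇒InV a∈S′))
  ... | no a∉S   = ⊥-elim (a∉S a∈S)

  open Covering (_∈A Sα) default

  α-covered : ∀ {X x} → x ∈ α → Covered X x
  α-covered x∈α = inj₂ (α-attr-∉A S α x∈α , sym (default-α x∈α))

  EdgesCover : (a : ℕ) {k : ℕ} → (Fin k → EVal) → Set
  EdgesCover a lab = ∀ e → (∃ λ i → lab i ≡ e) ⇔ Allowed md S a e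

  defaultEdge : ∀ {a k} {lab : Fin k → EVal} → a ∈A S → EdgesCover a lab → ∃ λ i → lab i ≡ default a
  defaultEdge a∈S edges = Equivalence.from (edges _) (default-allowed a∈S)

  keptEdges : (a : ℕ) {k : ℕ} → (Fin k → EVal) → List (Fin k)
  keptEdges a = selectEdges (allowed? md Sα a)

  restrictTree : (Γ : Tree) → TreeOver md S Γ → Tree
  restrictTree (leaf L) _ = leaf (restrictSys L α)
  restrictTree (node a k lab sub) (a∈S , _ , edges , over) with a ∈A? Sα
  ... | yes _ = node a (length (keptEdges a lab)) (lab ∘ lookup (keptEdges a lab))
                  (λ j → restrictTree (sub (lookup (keptEdges a lab) j)) (over _))
  ... | no _  = restrictTree (sub (proj₁ (defaultEdge a∈S edges))) (over _)

  restrictTree-over : (Γ : Tree) (t : TreeOver md S Γ) → TreeOver md Sα (restrictTree Γ t)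
  restrictTree-over (leaf L) rules = All.tabulate (restrictSys-∈R rules)
  restrictTree-over (node a k lab sub) (a∈S , injective , edges , over) with a ∈A? Sα
  ... | yes a∈Sα = a∈Sα
                 , selectEdges-injective (allowed? md Sα a) lab injective
                 , selectEdges-image (allowed? md Sα a) lab
                     (Equivalence.from (edges _) ∘ Allowed-restrictSys md)
                 , λ j → restrictTree-over _ (over _)
  ... | no _     = restrictTree-over _ (over _)

  record Lifting (Γ : Tree) {Γ′ : Tree} (ξ′ : Path Γ′) : Set where
    field
      path    : Path Γ
      depth-≤ : h ξ′ ≤ h path
      τ-≡     : τ ξ′ ≡ restrictSys (τ path) α
      attr-∈A : ∀ {x} → x ∈ KP ξ′ → proj₁ x ∈A Sα
      covered : ∀ {x} → x ∈ KP path → Covered (KP ξ′) x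

  liftPath : (Γ : Tree) (t : TreeOver md S Γ) (ξ′ : Path (restrictTree Γ t)) → Lifting Γ ξ′
  liftPath (leaf L) _ end = record
    { path = end ; depth-≤ = z≤n ; τ-≡ = refl ; attr-∈A = λ () ; covered = λ () }
  liftPath (node a k lab sub) (a∈S , _ , edges , over) ξ′ with a ∈A? Sα
  liftPath (node a k lab sub) (a∈S , _ , edges , over) (step j ξ′) | yes a∈Sα = record
    { path    = step (lookup (keptEdges a lab) j) path
    ; depth-≤ = s≤s depth-≤
    ; τ-≡     = τ-≡
    ; attr-∈A = λ { (here refl) → a∈Sα ; (there x∈) → attr-∈A x∈ }
    ; covered = λ { (here refl) → inj₁ (here refl) ; (there x∈) → Sum.map₁ there (covered x∈) }
    }
    where open Lifting (liftPath _ (over _) ξ′)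
  ... | no a∉Sα = record
    { path    = step i path
    ; depth-≤ = m≤n⇒m≤1+n depth-≤
    ; τ-≡     = τ-≡
    ; attr-∈A = attr-∈A
    ; covered = λ { (here refl) → inj₂ (a∉Sα , lab-i≡default) ; (there x∈) → covered x∈ }
    }
    where
    i : Fin k
    i = proj₁ (defaultEdge a∈S edges)
    lab-i≡default : lab i ≡ default a
    lab-i≡default = proj₂ (defaultEdge a∈S edges)
    open Lifting (liftPath _ (over i) ξ′)

  restrictTree-depth : ∀ {Γ d} (t : TreeOver md S Γ) → DepthLE Γ d → DepthLE (restrictTree Γ t) d
  restrictTree-depth t depth ξ′ = ≤-trans depth-≤ (depth path)
    where open Lifting (liftPath _ t ξ′)

  module _ {Γ : Tree} (t : TreeOver md S Γ) (ξ′ : Path (restrictTree Γ t)) (ξ′-consistent : Consistent (KP ξ′)) where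
    open Lifting (liftPath Γ t ξ′) renaming (path to ξ)

    KP++α-consistent : Consistent (KP ξ ++ α)
    KP++α-consistent = ξ′-consistent ∘ covered-inconsistent cover attr-∈A
      where
      cover : ∀ {x} → x ∈ KP ξ ++ α → Covered (KP ξ′) x
      cover x∈ with ∈-++⁻ (KP ξ) x∈
      ... | inj₁ x∈ξ = covered x∈ξ
      ... | inj₂ x∈α = α-covered x∈α

    KP-consistent : Consistent (KP ξ)
    KP-consistent = consistent-⊆ (xs⊆xs++ys (KP ξ) α) KP++α-consistent

    restrict-inconsistent : ∀ {s} → s ∈ S → Consistent (K s ++ α) → Inconsistent (K s ++ KP ξ) →
                            Inconsistent (K (restrictRule α s) ++ KP ξ′)
    restrict-inconsistent {s} s∈S s-consistent = covered-inconsistent cover attr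
      where
      cover : ∀ {x} → x ∈ K s ++ KP ξ → Covered (K (restrictRule α s) ++ KP ξ′) x
      cover x∈ with ∈-++⁻ (K s) x∈
      ... | inj₂ x∈ξ = Sum.map₁ (∈-++⁺ʳ _) (covered x∈ξ)
      ... | inj₁ x∈s with DecMembership._∈?_ _≟Eqn_ _ α
      ...   | yes x∈α = α-covered x∈α
      ...   | no x∉α  = inj₁ (∈-++⁺ˡ (∈-K-restrictRule⁺ α s x∈s x∉α))
      attr : ∀ {x} → x ∈ K (restrictRule α s) ++ KP ξ′ → proj₁ x ∈A Sα
      attr x∈ with ∈-++⁻ (K (restrictRule α s)) x∈
      ... | inj₁ x∈sα = ∈K⇒∈A x∈sα (∈-restrictSys⁺ s∈S s-consistent)
      ... | inj₂ x∈ξ′ = attr-∈A x∈ξ′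

    module _ (τ-satisfied : ∀ {r} → r ∈ τ ξ → K r ⊆ KP ξ) where

      τ-consistent : ∀ {r} → r ∈ τ ξ → Consistent (K r ++ α)
      τ-consistent r∈ = consistent-⊆ (++⁺ˡ α (τ-satisfied r∈)) KP++α-consistent

      restrict-∈τ : ∀ {r} → r ∈ τ ξ → restrictRule α r ∈ τ ξ′
      restrict-∈τ r∈ = subst (_ ∈_) (sym τ-≡) (∈-restrictSys⁺ r∈ (τ-consistent r∈))

      τ′-satisfied : ∀ {r} → r ∈ τ ξ′ → K r ⊆ KP ξ′
      τ′-satisfied r∈ e∈ with ∈-restrictSys⁻ {L = τ ξ} (subst (_ ∈_) τ-≡ r∈)
      ... | r₀ , r₀∈ , r₀-consistent , refl with ∈-K-restrictRule⁻ α r₀ e∈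
      ... | e∈r₀ , _ with covered (τ-satisfied r₀∈ e∈r₀)
      ...   | inj₁ e∈ξ′ = e∈ξ′
      ...   | inj₂ (e∉Sα , _) =
              ⊥-elim (e∉Sα (∈R⇒∈A (∈R-restrictSys⁺ (All.lookup (τ-∈R t ξ) r₀∈) r₀-consistent) e∈))

    pathCond-restrict : ∀ kd → PathCond kd S ξ → PathCond kd Sα ξ′
    pathCond-restrict kAR (τ-satisfied , separated) = τ′-satisfied τ-satisfied , λ r∈ r∉τ′ → go r∈ r∉τ′
      where
      go : ∀ {r} → r ∈ Sα → ¬ (r ∈R τ ξ′) → Inconsistent (K r ++ KP ξ′)
      go r∈ r∉τ′ with ∈-restrictSys⁻ {L = S} r∈
      ... | s , s∈S , s-consistent , refl = restrict-inconsistent s∈S s-consistent (separated s∈S s∉τ)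
        where
        s∉τ : ¬ (s ∈R τ ξ)
        s∉τ s∈τ with find s∈τ
        ... | u , u∈τ , s≈u = r∉τ′ (lose (restrict-∈τ τ-satisfied u∈τ) (restrictRule-≈R α s≈u))
    pathCond-restrict kAD (τ-satisfied , separated) = τ′-satisfied τ-satisfied , λ r∈ rhs∉τ′ → go r∈ rhs∉τ′
      where
      go : ∀ {r} → r ∈ Sα → ¬ (rhs r ∈ map rhs (τ ξ′)) → Inconsistent (K r ++ KP ξ′)
      go r∈ rhs∉τ′ with ∈-restrictSys⁻ {L = S} r∈
      ... | s , s∈S , s-consistent , refl = restrict-inconsistent s∈S s-consistent (separated s∈S rhs∉τ)
        where
        rhs∉τ : ¬ (rhs s ∈ map rhs (τ ξ))
        rhs∉τ rhs∈τ with ∈-map⁻ rhs rhs∈τ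
        ... | u , u∈τ , refl = rhs∉τ′ (∈-map⁺ rhs (restrict-∈τ τ-satisfied u∈τ))
    pathCond-restrict kSR (τ-satisfied , separated) = τ′-satisfied τ-satisfied , go
      where
      go : τ ξ′ ≡ [] → ∀ {r} → r ∈ Sα → Inconsistent (K r ++ KP ξ′)
      go τ′≡[] r∈ with ∈-restrictSys⁻ {L = S} r∈
      ... | s , s∈S , s-consistent , refl = restrict-inconsistent s∈S s-consistent (separated τ≡[] s∈S)
        where
        τ≡[] : τ ξ ≡ []
        τ≡[] = restrictSys-≡[] (τ-consistent τ-satisfied) (trans (sym τ-≡) τ′≡[])

  restrictTree-solves : ∀ C {Γ} (t : TreeOver md S Γ) → Solves C S Γ → Solves C Sα (restrictTree Γ t)
  restrictTree-solves C t solves ξ′ ξ′-consistent =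
    pathCond-restrict t ξ′ ξ′-consistent (kind C) (solves ξ (KP-consistent t ξ′ ξ′-consistent))
    where open Lifting (liftPath _ t ξ′) using () renaming (path to ξ)

lemma6 : (C : Problem) (S : List Rule) → S ≢ [] → All WFRule S → PosN S →
         (α : List Eqn) → Consistent α →
         All (λ e → (proj₁ e ∈A S) × Allowed (mode C) S (proj₁ e) (proj₂ e)) α →
         restrictSys S α ≢ [] →
         (d : ℕ) → HC≤ C S d → HC≤ C (restrictSys S α) d
lemma6 C S _ _ n>0 α α-consistent α-allowed _ d (inj₁ n≡0) = ⊥-elim (n≡0 n>0)
lemma6 C S _ _ _ α α-consistent α-allowed _ d (inj₂ (Γ , over , solves , depth)) =
  inj₂ ( restrictTree Γ over
       , restrictTree-over Γ over
       , restrictTree-solves C over solves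
       , restrictTree-depth over depth )
  where open Restriction (mode C) S α α-consistent α-allowed
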